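{- Let $G$ be a simple graph (possibly infinite) and $H$ a finite simple graph. Let $\psi:V(G)\to\{1,\dots,k\}$ be a perfect coloring of $G$, and let $\phi_1,\dots,\phi_k$ be perfect colorings of $H$ with color sets $J_1,\dots,J_k$ respectively, where $J_p\cap J_q=\varnothing$ for $p\ne q$. Then the coloring $\psi\cdot\Phi:V(G)\times V(H)\to J_1\cup\dots\cup J_k$ defined by $\psi\cdot\Phi(v_1,v_2)=\phi_{\psi(v_1)}(v_2)$ is a perfect coloring of the lexicographic product $G\cdot H$.
   Context: The lexicographic product $G\cdot H$ has vertex set $V(G)\times V(H)$, with $(u_1,v_1)$ adjacent to $(u_2,v_2)$ iff $\{u_1,u_2\}\in E(G)$, or $u_1=u_2$ and $\{v_1,v_2\}\in E(H)$. A coloring with a finite set of colors is perfect with parameter matrix $(m_{ab})$ if every vertex of color $a$ is adjacent to exactly $m_{ab}$ vertices of color $b$, for all colors $a,b$. -}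

module Defs where

open import Level using (0ℓ)
open import Data.Nat using (ℕ)
open import Data.Fin using (Fin)
open import Data.Product using (Σ; _×_; _,_; proj₁; proj₂)
open import Data.Sum using (_⊎_)
open import Data.Empty using (⊥)
open import Relation.Binary.PropositionalEquality using (_≡_)
open import Function.Bundles using (_↔_)

record Graph : Set₁ where
  field
    V      : Set
    Adj    : V → V → Set
    prop   : ∀ {u v} (p q : Adj u v) → p ≡ q
    sym    : ∀ {u v} → Adj u v → Adj v u
    irrefl : ∀ {u} → Adj u u → ⊥

FiniteGraph : ℕ → Set₁
FiniteGraph n = Σ Graph λ H → Graph.V H ≡ Fin n

HasSize : Set → ℕ → Set
HasSize A n = Fin n ↔ A

NbrsOfColor : (G : Graph) {C : Set} → (Graph.V G → C) → Graph.V G → C → Set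
NbrsOfColor G c v b = Σ (Graph.V G) λ u → Graph.Adj G v u × c u ≡ b

IsPerfectWith : (G : Graph) {C : Set} → (Graph.V G → C) → (C → C → ℕ) → Set
IsPerfectWith G c M = ∀ v b → HasSize (NbrsOfColor G c v b) (M (c v) b)

IsPerfect : (G : Graph) {C : Set} → (Graph.V G → C) → Set
IsPerfect G {C} c = Σ (C → C → ℕ) λ M → IsPerfectWith G c M

LexAdj : (G H : Graph) → Graph.V G × Graph.V H → Graph.V G × Graph.V H → Set
LexAdj G H (u₁ , v₁) (u₂ , v₂) =
  Graph.Adj G u₁ u₂ ⊎ (u₁ ≡ u₂ × Graph.Adj H v₁ v₂)

module _ where
  open import Data.Sum using (inj₁; inj₂)
  open import Relation.Binary.PropositionalEquality using (refl; cong; cong₂) renaming (sym to ≡-sym)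
  open import Data.Empty using (⊥-elim)

  private
    lexProp : (G H : Graph) → ∀ {x y} (p q : LexAdj G H x y) → p ≡ q
    lexProp G H (inj₁ p) (inj₁ q) = cong inj₁ (Graph.prop G p q)
    lexProp G H (inj₁ p) (inj₂ (refl , _)) = ⊥-elim (Graph.irrefl G p)
    lexProp G H (inj₂ (refl , _)) (inj₁ q) = ⊥-elim (Graph.irrefl G q)
    lexProp G H (inj₂ (refl , p)) (inj₂ (refl , q)) = cong (λ r → inj₂ (refl , r)) (Graph.prop H p q)

    lexSym : (G H : Graph) → ∀ {x y} → LexAdj G H x y → LexAdj G H y x
    lexSym G H (inj₁ p) = inj₁ (Graph.sym G p)
    lexSym G H (inj₂ (e , p)) = inj₂ (≡-sym e , Graph.sym H p)

    lexIrr : (G H : Graph) → ∀ {x} → LexAdj G H x x → ⊥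
    lexIrr G H (inj₁ p) = Graph.irrefl G p
    lexIrr G H (inj₂ (_ , p)) = Graph.irrefl H p

  _·_ : Graph → Graph → Graph
  G · H = record
    { V      = Graph.V G × Graph.V H
    ; Adj    = LexAdj G H
    ; prop   = lexProp G H
    ; sym    = lexSym G H
    ; irrefl = lexIrr G H
    }

-- The combined coloring ψ·Φ (v₁ , v₂) = φ_{ψ(v₁)}(v₂), valued in the disjoint
-- union J₁ ⊔ … ⊔ J_k, represented as Σ p, J p.
lexColoring : (G H : Graph) {k : ℕ} {J : Fin k → Set}
  → (Graph.V G → Fin k) → ((p : Fin k) → Graph.V H → J p)
  → Graph.V G × Graph.V H → Σ (Fin k) J
lexColoring G H ψ φ (v₁ , v₂) = ψ v₁ , φ (ψ v₁) v₂

-- A neighbour of (u , v) in G · H is either (u′ , v′) with u′ adjacent to u in G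
-- and v′ arbitrary, or (u , v′) with v′ adjacent to v in H.  Hence the neighbours
-- of colour (q , j) split into the pairs of a ψ-coloured G-neighbour of colour q
-- with a vertex of the fibre φ_q⁻¹(j), plus, only when ψ u = q, the H-neighbours
-- of v of φ_q-colour j.  Their number M_G(p , q) · |φ_q⁻¹(j)| + [p = q] M_p(i , j)
-- depends only on the colours (p , i) of (u , v) and (q , j); finiteness of H is
-- used only to give the fibres a size.

module Submission where

open import Defs
open import Data.Nat using (ℕ; zero; suc; _+_; _*_)
open import Data.Fin using (Fin; zero; suc)
open import Data.Fin.Properties using (_≟_; +↔⊎; *↔×)
open import Data.Product using (Σ; ∃; proj₁; proj₂; _×_; _,_)
open import Data.Product.Function.NonDependent.Propositional using (_×-↔_)
open import Data.Sum using (_⊎_; inj₁; inj₂)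
open import Data.Sum.Function.Propositional using (_⊎-↔_)
open import Data.Empty using (⊥-elim)
open import Function using (_∘_)
open import Function.Bundles using (_↔_; mk↔ₛ′)
open import Function.Properties.Inverse using (↔-trans)
open import Relation.Nullary using (¬_; Dec; yes; no; Irrelevant)
open import Relation.Unary using (Decidable)
open import Relation.Binary.Definitions using (DecidableEquality)
open import Relation.Binary.PropositionalEquality using (_≡_; refl)
open import Axiom.UniquenessOfIdentityProofs using (module Decidable⇒UIP)

Finite : Set → Set
Finite A = ∃ (HasSize A)

Fibre : {A B : Set} → (A → B) → B → Set
Fibre {A} f b = Σ A λ a → f a ≡ b

HasSize-0 : {A : Set} → ¬ A → HasSize A 0
HasSize-0 ¬a = mk↔ₛ′ (λ ()) (⊥-elim ∘ ¬a) (⊥-elim ∘ ¬a) (λ ())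

HasSize-1 : {A : Set} → Irrelevant A → A → HasSize A 1
HasSize-1 irr a = mk↔ₛ′ (λ _ → a) (λ _ → zero) (irr a) (λ { zero → refl })

Dec⇒Finite : {A : Set} → Irrelevant A → Dec A → Finite A
Dec⇒Finite irr (yes a) = 1 , HasSize-1 irr a
Dec⇒Finite irr (no ¬a) = 0 , HasSize-0 ¬a

⊎-HasSize : ∀ {A B m n} → HasSize A m → HasSize B n → HasSize (A ⊎ B) (m + n)
⊎-HasSize |A| |B| = ↔-trans +↔⊎ (|A| ⊎-↔ |B|)

×-HasSize : ∀ {A B m n} → HasSize A m → HasSize B n → HasSize (A × B) (m * n)
×-HasSize |A| |B| = ↔-trans *↔× (|A| ×-↔ |B|)

Σ-Fin-suc-↔ : ∀ {n} (P : Fin (suc n) → Set) → (P zero ⊎ Σ (Fin n) (P ∘ suc)) ↔ Σ (Fin (suc n)) P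
Σ-Fin-suc-↔ P = mk↔ₛ′ to from to∘from from∘to
  where
  to : P zero ⊎ Σ _ (P ∘ suc) → Σ _ P
  to (inj₁ p)       = zero , p
  to (inj₂ (i , p)) = suc i , p
  from : Σ _ P → P zero ⊎ Σ _ (P ∘ suc)
  from (zero , p)  = inj₁ p
  from (suc i , p) = inj₂ (i , p)
  to∘from : ∀ x → to (from x) ≡ x
  to∘from (zero , p)  = refl
  to∘from (suc i , p) = refl
  from∘to : ∀ x → from (to x) ≡ x
  from∘to (inj₁ p) = refl
  from∘to (inj₂ _) = refl

Σ-Fin-finite : ∀ {n} {P : Fin n → Set} → (∀ i → Irrelevant (P i)) → Decidable P → Finite (Σ (Fin n) P)
Σ-Fin-finite {zero}      irr P? = 0 , HasSize-0 (λ ())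
Σ-Fin-finite {suc n} {P} irr P?
  with c₀ , |P₀| ← Dec⇒Finite (irr zero) (P? zero)
     | c , |P∘suc| ← Σ-Fin-finite (irr ∘ suc) (P? ∘ suc)
  = c₀ + c , ↔-trans (⊎-HasSize |P₀| |P∘suc|) (Σ-Fin-suc-↔ P)

Fibre-finite : ∀ {A B : Set} {n} → A ≡ Fin n → DecidableEquality B → (f : A → B) (b : B) → Finite (Fibre f b)
Fibre-finite refl _≟ᴮ_ f b = Σ-Fin-finite (λ _ → Decidable⇒UIP.≡-irrelevant _≟ᴮ_) (λ a → f a ≟ᴮ b)

blockDiagonal : ∀ {k} {J : Fin k → Set} → ((p : Fin k) → J p → J p → ℕ) → Σ (Fin k) J → Σ (Fin k) J → ℕ
blockDiagonal N (p , i) (q , j) with p ≟ q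
... | yes refl = N p i j
... | no _     = 0

module _ (G H : Graph) {k : ℕ} {J : Fin k → Set}
         (ψ : Graph.V G → Fin k) (φ : (p : Fin k) → Graph.V H → J p) where

  private
    χ = lexColoring G H {k} {J} ψ φ

  NbrsOfColor-lex-↔ : ∀ {u v q j} →
    (NbrsOfColor G ψ u q × Fibre (φ q) j ⊎ (ψ u ≡ q) × NbrsOfColor H (φ q) v j)
      ↔ NbrsOfColor (G · H) χ (u , v) (q , j)
  NbrsOfColor-lex-↔ = mk↔ₛ′ to from to∘from from∘to
    where
    to : ∀ {u v q j} →
      NbrsOfColor G ψ u q × Fibre (φ q) j ⊎ (ψ u ≡ q) × NbrsOfColor H (φ q) v j →
      NbrsOfColor (G · H) χ (u , v) (q , j)
    to (inj₁ ((u′ , a , refl) , v′ , refl)) = (u′ , v′) , inj₁ a , refl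
    to {u} (inj₂ (refl , v′ , a , refl))   = (u , v′) , inj₂ (refl , a) , refl
    from : ∀ {u v q j} → NbrsOfColor (G · H) χ (u , v) (q , j) →
      NbrsOfColor G ψ u q × Fibre (φ q) j ⊎ (ψ u ≡ q) × NbrsOfColor H (φ q) v j
    from ((u′ , v′) , inj₁ a , refl)          = inj₁ ((u′ , a , refl) , v′ , refl)
    from ((u′ , v′) , inj₂ (refl , a) , refl) = inj₂ (refl , v′ , a , refl)
    to∘from : ∀ {u v q j} (x : NbrsOfColor (G · H) χ (u , v) (q , j)) → to (from x) ≡ x
    to∘from ((u′ , v′) , inj₁ a , refl)          = refl
    to∘from ((u′ , v′) , inj₂ (refl , a) , refl) = refl
    from∘to : ∀ {u v q j} (x : NbrsOfColor G ψ u q × Fibre (φ q) j ⊎ (ψ u ≡ q) × NbrsOfColor H (φ q) v j) →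
      from {u} {v} (to x) ≡ x
    from∘to (inj₁ ((u′ , a , refl) , v′ , refl)) = refl
    from∘to (inj₂ (refl , v′ , a , refl))        = refl

  lexMatrix : (Fin k → Fin k → ℕ) → ((q : Fin k) → J q → ℕ) → ((p : Fin k) → J p → J p → ℕ) →
    Σ (Fin k) J → Σ (Fin k) J → ℕ
  lexMatrix M fibreSize N (p , i) (q , j) = M p q * fibreSize q j + blockDiagonal N (p , i) (q , j)

  sameBlock-HasSize : {N : (p : Fin k) → J p → J p → ℕ} → (∀ p → IsPerfectWith H (φ p) (N p)) →
    ∀ p v q j → HasSize ((p ≡ q) × NbrsOfColor H (φ q) v j) (blockDiagonal N (p , φ p v) (q , j))
  sameBlock-HasSize perfectH p v q j with p ≟ q
  ... | yes refl = ↔-trans (perfectH p v j) (mk↔ₛ′ (refl ,_) proj₂ sameBlock-refl (λ _ → refl))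
    where
    sameBlock-refl : (x : (p ≡ p) × NbrsOfColor H (φ p) v j) → (refl , proj₂ x) ≡ x
    sameBlock-refl (refl , _) = refl
  ... | no p≢q   = HasSize-0 (p≢q ∘ proj₁)

  lex-IsPerfectWith : ∀ {M N fibreSize} → IsPerfectWith G ψ M → (∀ p → IsPerfectWith H (φ p) (N p)) →
    (∀ q j → HasSize (Fibre (φ q) j) (fibreSize q j)) →
    IsPerfectWith (G · H) χ (lexMatrix M fibreSize N)
  lex-IsPerfectWith perfectG perfectH |Fibre| (u , v) (q , j) =
    ↔-trans (⊎-HasSize (×-HasSize (perfectG u q) (|Fibre| q j)) (sameBlock-HasSize perfectH (ψ u) v q j))
            NbrsOfColor-lex-↔

lemma1 : (G : Graph) (n : ℕ) (H : FiniteGraph n) (k : ℕ) (m : Fin k → ℕ)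
    (ψ : Graph.V G → Fin k)
    (φ : (p : Fin k) → Graph.V (proj₁ H) → Fin (m p))
    → IsPerfect G ψ
    → ((p : Fin k) → IsPerfect (proj₁ H) (φ p))
    → IsPerfect (G · proj₁ H) (lexColoring G (proj₁ H) {k} {λ p → Fin (m p)} ψ φ)
lemma1 G n (H , V≡Fin) k m ψ φ (M , perfectG) perfectH =
  lexMatrix G H ψ φ M (λ q j → proj₁ (fibre q j)) (proj₁ ∘ perfectH) ,
  lex-IsPerfectWith G H ψ φ {M} perfectG (proj₂ ∘ perfectH) (λ q j → proj₂ (fibre q j))
  where
  fibre : (q : Fin k) (j : Fin (m q)) → Finite (Fibre (φ q) j)
  fibre q = Fibre-finite V≡Fin _≟_ (φ q)
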